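{- Let $f\colon\{0,1\}^n\to\{0,1,\perp\}$ be a partial function and let $F(x,y)=f(x\oplus y)$. Suppose $\mathrm{D_{cc}^{\rightarrow}}(F)=t$ and $f$ is undefined (i.e. takes value $\perp$) on fewer than $\binom{n-t+1}{\lfloor\frac{n-t}{2}\rfloor-1}$ inputs. Then $\mathrm{NADT^{\oplus}}(f)=t$.
   Context: For a partial function $f\colon\{0,1\}^n\to\{0,1,\perp\}$ let $\operatorname{Dom}(f)=f^{ -1}(\{0,1\})$. $\oplus$ denotes bitwise XOR, and $F(x,y)=f(x\oplus y)$ has domain $\operatorname{Dom}(F)=\{(x,y): x\oplus y\in\operatorname{Dom}(f)\}$. A one-way communication protocol of cost $t$ for $F$ consists of total functions $h\colon\{0,1\}^n\to\{0,1\}^t$ and $\varphi\colon\{0,1\}^t\times\{0,1\}^n\to\{0,1\}$ such that $\varphi(h(x),y)=F(x,y)$ for all $(x,y)\in\operatorname{Dom}(F)$; $\mathrm{D_{cc}^{\rightarrow}}(F)$ is the minimum such $t$. For $s,x\in\{0,1\}^n$ let $\langle s,x\rangle=\bigoplus_i s_i\wedge x_i$. A non-adaptive parity decision tree of cost $p$ for $f$ consists of vectors $s_1,\dots,s_p\in\{0,1\}^n$ and a total function $l\colon\{0,1\}^p\to\{0,1\}$ with $l(\langle s_1,x\rangle,\dots,\langle s_p,x\rangle)=f(x)$ for all $x\in\operatorname{Dom}(f)$; $\mathrm{NADT^{\oplus}}(f)$ is the minimum such $p$. -}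

module Defs where

open import Data.Bool using (Bool; true; false; _xor_; _∧_)
open import Data.Maybe using (Maybe; just; nothing; is-nothing)
open import Data.Nat using (ℕ; zero; suc; _≤_)
open import Data.List using (List; []; _∷_; _++_; map; filter; length)
open import Data.Vec using (Vec; []; _∷_; zipWith; foldr′)
open import Data.Product using (Σ; _×_; ∃)
open import Relation.Binary.PropositionalEquality using (_≡_)
open import Data.Bool.Properties using (T?)

-- A partial function {0,1}^n → {0,1,⊥}: nothing plays the role of ⊥.
Partial : ℕ → Set
Partial n = Vec Bool n → Maybe Bool

_⊕_ : ∀ {n} → Vec Bool n → Vec Bool n → Vec Bool n
_⊕_ = zipWith _xor_

⟨_,_⟩ : ∀ {n} → Vec Bool n → Vec Bool n → Bool
⟨ s , x ⟩ = foldr′ _xor_ false (zipWith _∧_ s x)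

allInputs : (n : ℕ) → List (Vec Bool n)
allInputs zero = [] ∷ []
allInputs (suc n) = map (false ∷_) (allInputs n) ++ map (true ∷_) (allInputs n)

undefCount : ∀ {n} → Partial n → ℕ
undefCount {n} f = length (filter (λ x → T? (is-nothing (f x))) (allInputs n))

-- One-way protocol of cost t for F(x,y) = f(x ⊕ y):
-- total h, φ with φ(h x, y) = F(x,y) whenever (x,y) ∈ Dom(F).
OneWayProtocol : ∀ {n} → Partial n → ℕ → Set
OneWayProtocol {n} f t =
  Σ (Vec Bool n → Vec Bool t) λ h →
  Σ (Vec Bool t → Vec Bool n → Bool) λ φ →
  ∀ x y b → f (x ⊕ y) ≡ just b → φ (h x) y ≡ b

Dcc→ : ∀ {n} → Partial n → ℕ → Set
Dcc→ f t = OneWayProtocol f t × (∀ t′ → OneWayProtocol f t′ → t ≤ t′)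

NAPDT : ∀ {n} → Partial n → ℕ → Set
NAPDT {n} f p =
  Σ (Vec (Vec Bool n) p) λ s →
  Σ (Vec Bool p → Bool) λ l →
  ∀ x b → f x ≡ just b → l (Data.Vec.map (λ sᵢ → ⟨ sᵢ , x ⟩) s) ≡ b

NADT⊕ : ∀ {n} → Partial n → ℕ → Set
NADT⊕ f p = NAPDT f p × (∀ p′ → NAPDT f p′ → p ≤ p′)

{-# OPTIONS --safe #-}
module Submission where

-- Fix an optimal protocol (h, φ). Some message μ is sent on a set A of at least 2^(n−t)
-- inputs, and Bob's answer φ μ agrees with f (a ⊕ ·) on its domain for every a ∈ A.
-- The binomial hypothesis makes f undefined on fewer than |A|/2 points, so for every y
-- some a ∈ A has f defined at both a ⊕ y and a ⊕ y ⊕ a₁ ⊕ a₂; hence every a₁ ⊕ a₂ with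
-- a₁, a₂ ∈ A is a period of φ μ. The periods form a subgroup of {0,1}ⁿ with at least
-- 2^(n−t) elements, so it contains the common kernel of some r ≤ t parities, and f is
-- constant on the domain part of each coset of that kernel: these parities compute f.
-- Conversely a parity tree with p queries is a one-way protocol of cost p.

open import Defs
open import Data.Nat using (ℕ; _∸_; _+_; _/_; _≤_; _<_)
open import Data.Nat.Combinatorics using (_C_)

open import Algebra.Bundles using (CommutativeSemigroup; CommutativeRing)
open import Algebra.Definitions using (Associative)
import Algebra.Properties.CommutativeSemigroup as CommutativeSemigroupProperties
open import Data.Bool as Bool using (Bool; true; false; _xor_; _∧_; _∨_; not; T; if_then_else_)
open import Data.Bool.Properties
  using (T?; ∧-assoc; ∧-zeroʳ; ∧-identityʳ; ∧-distribˡ-xor; xor-assoc; xor-comm; xor-same;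
         xor-identityʳ; xor-∧-commutativeRing)
open import Data.Empty using (⊥-elim)
open import Data.List as List using (List; []; _∷_; _++_; filter; length)
open import Data.List.Properties using (filter-++; length-++)
open import Data.Maybe using (Maybe; just; is-nothing)
import Data.Maybe.Properties as Maybe
open import Data.Nat using (zero; suc; _*_; _^_; z≤n; s≤s; z<s; NonZero; >-nonZero)
open import Data.Nat.Combinatorics using (nCk≡nC[n∸k]; k>n⇒nCk≡0; nCk+nC[k+1]≡[n+1]C[k+1])
open import Data.Nat.DivMod using (m/n*n≤m)
open import Data.Nat.Properties
open import Data.Nat.Tactic.RingSolver using (solve-∀)
open import Data.Product using (Σ; ∃; _×_; _,_)
import Data.Product as Product
open import Data.Sum using (inj₁; inj₂)
open import Data.Unit using (tt)
open import Data.Vec using (Vec; []; _∷_; head; tail; map; replicate; truncate; padRight)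
open import Data.Vec.Properties
  using (≡-dec; ∷-injectiveˡ; ∷-injectiveʳ; zipWith-assoc; zipWith-comm; zipWith-identityʳ)
open import Function using (_∘_; id; case_of_)
open import Relation.Binary.PropositionalEquality
open import Relation.Binary.PropositionalEquality.Algebra using (isMagma)
open import Relation.Nullary using (¬_; Dec; yes; no; does)
open import Relation.Nullary.Decidable
  using (map′; _×-dec_; _⊎-dec_; ¬?; dec-true; dec-false; decidable-stable)

-- The vector space {0,1}ⁿ and parities

zeros : ∀ {n} → Vec Bool n
zeros = replicate _ false

⊕-assoc : ∀ {n} → Associative _≡_ (_⊕_ {n})
⊕-assoc = zipWith-assoc xor-assoc

⊕-comm : ∀ {n} (x y : Vec Bool n) → x ⊕ y ≡ y ⊕ x
⊕-comm = zipWith-comm xor-comm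

⊕-identityʳ : ∀ {n} (x : Vec Bool n) → x ⊕ zeros ≡ x
⊕-identityʳ = zipWith-identityʳ xor-identityʳ

⊕-self : ∀ {n} (x : Vec Bool n) → x ⊕ x ≡ zeros
⊕-self []      = refl
⊕-self (b ∷ x) = cong₂ _∷_ (xor-same b) (⊕-self x)

⊕-cancelˡ : ∀ {n} (x y : Vec Bool n) → x ⊕ (x ⊕ y) ≡ y
⊕-cancelˡ x y = begin
  x ⊕ (x ⊕ y)   ≡⟨ ⊕-assoc x x y ⟨
  (x ⊕ x) ⊕ y   ≡⟨ cong (_⊕ y) (⊕-self x) ⟩
  zeros ⊕ y     ≡⟨ ⊕-comm zeros y ⟩
  y ⊕ zeros     ≡⟨ ⊕-identityʳ y ⟩
  y             ∎
  where open ≡-Reasoning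

⊕-commutativeSemigroup : ℕ → CommutativeSemigroup _ _
⊕-commutativeSemigroup n = record
  { Carrier                = Vec Bool n
  ; _≈_                    = _≡_
  ; _∙_                    = _⊕_
  ; isCommutativeSemigroup = record
    { isSemigroup = record { isMagma = isMagma _⊕_ ; assoc = ⊕-assoc }
    ; comm        = ⊕-comm
    }
  }

module ⊕-Properties {n} = CommutativeSemigroupProperties (⊕-commutativeSemigroup n)

open CommutativeSemigroupProperties (CommutativeRing.+-commutativeSemigroup xor-∧-commutativeRing)
  using () renaming (interchange to xor-interchange)
open CommutativeSemigroupProperties +-commutativeSemigroup
  using () renaming (interchange to +-interchange)

⟨⟩-⊕ : ∀ {n} (s x y : Vec Bool n) → ⟨ s , x ⊕ y ⟩ ≡ ⟨ s , x ⟩ xor ⟨ s , y ⟩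
⟨⟩-⊕ []      []      []      = refl
⟨⟩-⊕ (a ∷ s) (b ∷ x) (c ∷ y) = begin
  (a ∧ (b xor c)) xor ⟨ s , x ⊕ y ⟩
    ≡⟨ cong₂ _xor_ (∧-distribˡ-xor a b c) (⟨⟩-⊕ s x y) ⟩
  ((a ∧ b) xor (a ∧ c)) xor (⟨ s , x ⟩ xor ⟨ s , y ⟩)
    ≡⟨ xor-interchange (a ∧ b) (a ∧ c) ⟨ s , x ⟩ ⟨ s , y ⟩ ⟩
  ((a ∧ b) xor ⟨ s , x ⟩) xor ((a ∧ c) xor ⟨ s , y ⟩)
    ∎
  where open ≡-Reasoning

⟨zeros,⟩ : ∀ {n} (x : Vec Bool n) → ⟨ zeros , x ⟩ ≡ false
⟨zeros,⟩ []      = refl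
⟨zeros,⟩ (_ ∷ x) = ⟨zeros,⟩ x

parities : ∀ {n p} → Vec (Vec Bool n) p → Vec Bool n → Vec Bool p
parities s x = map (λ sᵢ → ⟨ sᵢ , x ⟩) s

parities-⊕ : ∀ {n p} (s : Vec (Vec Bool n) p) x y →
  parities s (x ⊕ y) ≡ parities s x ⊕ parities s y
parities-⊕ []      x y = refl
parities-⊕ (v ∷ s) x y = cong₂ _∷_ (⟨⟩-⊕ v x y) (parities-⊕ s x y)

parities-false∷ : ∀ {n p} (k : Vec Bool n → Bool) (s : Vec (Vec Bool n) p) y →
  parities (map (λ v → k v ∷ v) s) (false ∷ y) ≡ parities s y
parities-false∷ k []      y = refl
parities-false∷ k (v ∷ s) y =
  cong₂ _∷_ (cong (_xor ⟨ v , y ⟩) (∧-zeroʳ (k v))) (parities-false∷ k s y)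

parities-true∷ : ∀ {n p} (q : Vec Bool n) (s : Vec (Vec Bool n) p) y →
  parities (map (λ v → ⟨ v , q ⟩ ∷ v) s) (true ∷ y) ≡ parities s (q ⊕ y)
parities-true∷ q []      y = refl
parities-true∷ q (v ∷ s) y = cong₂ _∷_
  (trans (cong (_xor ⟨ v , y ⟩) (∧-identityʳ ⟨ v , q ⟩)) (sym (⟨⟩-⊕ v q y)))
  (parities-true∷ q s y)

∃? : ∀ {n} {P : Vec Bool n → Set} → (∀ x → Dec (P x)) → Dec (∃ P)
∃? {zero}  P? = map′ ([] ,_) (λ { ([] , p) → p }) (P? [])
∃? {suc n} P? = map′ from-⊎ to-⊎ (∃? (P? ∘ (false ∷_)) ⊎-dec ∃? (P? ∘ (true ∷_)))
  where
  from-⊎ = λ { (inj₁ (x , p)) → false ∷ x , p ; (inj₂ (x , p)) → true ∷ x , p }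
  to-⊎   = λ { (false ∷ x , p) → inj₁ (x , p) ; (true ∷ x , p) → inj₂ (x , p) }

∀? : ∀ {n} {P : Vec Bool n → Set} → (∀ x → Dec (P x)) → Dec (∀ x → P x)
∀? P? = map′ (λ ∄¬P x → decidable-stable (P? x) (λ ¬Px → ∄¬P (x , ¬Px)))
             (λ ∀P (x , ¬Px) → ¬Px (∀P x))
             (¬? (∃? (¬? ∘ P?)))

does⇒ : ∀ {a} {A : Set a} (a? : Dec A) → T (does a?) → A
does⇒ (yes a) _ = a

⇒does : ∀ {a} {A : Set a} (a? : Dec A) → A → T (does a?)
⇒does (yes _) _ = tt
⇒does (no ¬a) a = ¬a a

count : ∀ {n} → (Vec Bool n → Bool) → ℕ
count {zero}  P = if P [] then 1 else 0
count {suc n} P = count (P ∘ (false ∷_)) + count (P ∘ (true ∷_))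

count-cong : ∀ {n} {P Q : Vec Bool n → Bool} → P ≗ Q → count P ≡ count Q
count-cong {zero}  P≗Q = cong (λ b → if b then 1 else 0) (P≗Q [])
count-cong {suc n} P≗Q =
  cong₂ _+_ (count-cong (P≗Q ∘ (false ∷_))) (count-cong (P≗Q ∘ (true ∷_)))

count-mono : ∀ {n} {P Q : Vec Bool n → Bool} → (∀ x → T (P x) → T (Q x)) → count P ≤ count Q
count-mono {zero} {P} {Q} P⊆Q with P [] | Q [] | P⊆Q []
... | false | _     | _   = z≤n
... | true  | true  | _   = ≤-refl
... | true  | false | P⇒Q = ⊥-elim (P⇒Q tt)
count-mono {suc n} P⊆Q = +-mono-≤ (count-mono (P⊆Q ∘ (false ∷_))) (count-mono (P⊆Q ∘ (true ∷_)))

count-∨ : ∀ {n} (P Q : Vec Bool n → Bool) → count (λ x → P x ∨ Q x) ≤ count P + count Q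
count-∨ {zero}  P Q with P [] | Q []
... | false | false = z≤n
... | false | true  = ≤-refl
... | true  | _     = s≤s z≤n
count-∨ {suc n} P Q = begin
  count (λ x → P₀ x ∨ Q₀ x) + count (λ x → P₁ x ∨ Q₁ x)
    ≤⟨ +-mono-≤ (count-∨ P₀ Q₀) (count-∨ P₁ Q₁) ⟩
  (count P₀ + count Q₀) + (count P₁ + count Q₁)
    ≡⟨ +-interchange (count P₀) (count Q₀) (count P₁) (count Q₁) ⟩
  (count P₀ + count P₁) + (count Q₀ + count Q₁)
    ∎
  where
  open ≤-Reasoning
  P₀ = P ∘ (false ∷_)
  P₁ = P ∘ (true ∷_)
  Q₀ = Q ∘ (false ∷_)
  Q₁ = Q ∘ (true ∷_)

count-translate : ∀ {n} (c : Vec Bool n) (P : Vec Bool n → Bool) → count (P ∘ (c ⊕_)) ≡ count P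
count-translate []          P = refl
count-translate (false ∷ c) P =
  cong₂ _+_ (count-translate c (P ∘ (false ∷_))) (count-translate c (P ∘ (true ∷_)))
count-translate (true ∷ c)  P = begin
  count (P ∘ (true ∷_) ∘ (c ⊕_)) + count (P ∘ (false ∷_) ∘ (c ⊕_))
    ≡⟨ cong₂ _+_ (count-translate c (P ∘ (true ∷_))) (count-translate c (P ∘ (false ∷_))) ⟩
  count (P ∘ (true ∷_)) + count (P ∘ (false ∷_))
    ≡⟨ +-comm (count (P ∘ (true ∷_))) _ ⟩
  count (P ∘ (false ∷_)) + count (P ∘ (true ∷_))
    ∎
  where open ≡-Reasoning

count-true : ∀ n → count {n} (λ _ → true) ≡ 2 ^ n
count-true zero    = refl
count-true (suc n) = begin
  count {n} (λ _ → true) + count {n} (λ _ → true)   ≡⟨ cong₂ _+_ (count-true n) (count-true n) ⟩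
  2 ^ n + 2 ^ n                                     ≡⟨ cong (2 ^ n +_) (+-identityʳ (2 ^ n)) ⟨
  2 ^ suc n                                         ∎
  where open ≡-Reasoning

count-witness : ∀ {n} (P : Vec Bool n → Bool) → 0 < count P → ∃ (T ∘ P)
count-witness {zero}  P 0<count with P [] in P[]≡true
... | true = [] , subst T (sym P[]≡true) tt
count-witness {suc n} P 0<count with count (P ∘ (false ∷_)) in count₀
... | suc _ =
  Product.map (false ∷_) id (count-witness (P ∘ (false ∷_)) (subst (0 <_) (sym count₀) z<s))
... | zero  =
  Product.map (true ∷_) id (count-witness (P ∘ (true ∷_)) 0<count)

avoid-two-translates : ∀ {n} (A U : Vec Bool n → Bool) → count U + count U < count A →
  ∀ c d → ∃ λ a → T (A a) × T (not (U (a ⊕ c))) × T (not (U (a ⊕ d)))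
avoid-two-translates A U dense c d =
  let a , a∈Good = count-witness Good (+-cancelʳ-< (count U + count U) 0 (count Good) 2u<|Good|+2u)
  in a , Good⇒ a a∈Good
  where
  Good U[c] U[d] : Vec Bool _ → Bool
  Good a = A a ∧ not (U (a ⊕ c)) ∧ not (U (a ⊕ d))
  U[c] a = U (a ⊕ c)
  U[d] a = U (a ⊕ d)
  Good⇒ : ∀ a → T (Good a) → T (A a) × T (not (U (a ⊕ c))) × T (not (U (a ⊕ d)))
  Good⇒ a a∈Good with A a | U (a ⊕ c) | U (a ⊕ d)
  ... | true | false | false = tt , tt , tt
  A⊆Good∪U[c]∪U[d] : ∀ a → T (A a) → T (Good a ∨ (U[c] a ∨ U[d] a))
  A⊆Good∪U[c]∪U[d] a a∈A with A a | U (a ⊕ c) | U (a ⊕ d)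
  ... | true | false | false = tt
  ... | true | false | true  = tt
  ... | true | true  | _     = tt
  count-U[_] : ∀ e → count (λ a → U (a ⊕ e)) ≡ count U
  count-U[ e ] = trans (count-cong (λ a → cong U (⊕-comm a e))) (count-translate e U)
  2u<|Good|+2u : count U + count U < count Good + (count U + count U)
  2u<|Good|+2u = begin-strict
    count U + count U                            <⟨ dense ⟩
    count A                                      ≤⟨ count-mono A⊆Good∪U[c]∪U[d] ⟩
    count (λ a → Good a ∨ (U[c] a ∨ U[d] a))     ≤⟨ count-∨ Good _ ⟩
    count Good + count (λ a → U[c] a ∨ U[d] a)   ≤⟨ +-monoʳ-≤ (count Good) (count-∨ U[c] U[d]) ⟩
    count Good + (count U[c] + count U[d])       ≡⟨ cong₂ (λ k l → count Good + (k + l))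
                                                          count-U[ c ] count-U[ d ] ⟩
    count Good + (count U + count U)             ∎
    where open ≤-Reasoning

length-filter-map : ∀ {A B : Set} (P : B → Bool) (g : A → B) (xs : List A) →
  length (filter (T? ∘ P) (List.map g xs)) ≡ length (filter (T? ∘ P ∘ g) xs)
length-filter-map P g []       = refl
length-filter-map P g (x ∷ xs) with P (g x)
... | true  = cong suc (length-filter-map P g xs)
... | false = length-filter-map P g xs

length-filter-allInputs : ∀ n (P : Vec Bool n → Bool) →
  length (filter (T? ∘ P) (allInputs n)) ≡ count P
length-filter-allInputs zero    P with P []
... | true  = refl
... | false = refl
length-filter-allInputs (suc n) P = begin
  length (filter (T? ∘ P) (inputs (false ∷_) ++ inputs (true ∷_)))
    ≡⟨ cong length (filter-++ (T? ∘ P) (inputs (false ∷_)) _) ⟩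
  length (filter (T? ∘ P) (inputs (false ∷_)) ++ filter (T? ∘ P) (inputs (true ∷_)))
    ≡⟨ length-++ (filter (T? ∘ P) (inputs (false ∷_))) ⟩
  length (filter (T? ∘ P) (inputs (false ∷_))) + length (filter (T? ∘ P) (inputs (true ∷_)))
    ≡⟨ cong₂ _+_ (length-filter-inputs (false ∷_)) (length-filter-inputs (true ∷_)) ⟩
  count (P ∘ (false ∷_)) + count (P ∘ (true ∷_))
    ∎
  where
  open ≡-Reasoning
  inputs : (Vec Bool n → Vec Bool (suc n)) → List (Vec Bool (suc n))
  inputs g = List.map g (allInputs n)
  length-filter-inputs : ∀ g → length (filter (T? ∘ P) (inputs g)) ≡ count (P ∘ g)
  length-filter-inputs g =
    trans (length-filter-map P g (allInputs n)) (length-filter-allInputs n (P ∘ g))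

undefCount≡count : ∀ {n} (f : Partial n) → undefCount f ≡ count (is-nothing ∘ f)
undefCount≡count {n} f = length-filter-allInputs n (is-nothing ∘ f)

-- Pigeonhole on fibers

fiber : ∀ {n t} → (Vec Bool n → Vec Bool t) → Vec Bool t → Vec Bool n → Bool
fiber g μ x = does (≡-dec Bool._≟_ (g x) μ)

fiber-[] : ∀ {n} (g : Vec Bool n → Vec Bool 0) x → fiber g [] x ≡ true
fiber-[] g x with g x
... | [] = refl

fiber-∷ : ∀ {n t} (g : Vec Bool n → Vec Bool (suc t)) b μ x →
  fiber g (b ∷ μ) x ≡ does (head (g x) Bool.≟ b) ∧ fiber (tail ∘ g) μ x
fiber-∷ g b μ x with g x
... | _ ∷ _ = refl

sum≤double-larger : (c : Bool → ℕ) → ∃ λ b → c false + c true ≤ 2 * c b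
sum≤double-larger c with ≤-total (c false) (c true)
... | inj₁ c₀≤c₁ = true  , +-mono-≤ c₀≤c₁ (m≤m+n (c true) 0)
... | inj₂ c₁≤c₀ = false , +-monoʳ-≤ (c false) (≤-trans c₁≤c₀ (m≤m+n (c false) 0))

fiber-pigeonhole : ∀ {n t} (R : Vec Bool n → Bool) (g : Vec Bool n → Vec Bool t) →
  ∃ λ μ → count R ≤ 2 ^ t * count (λ x → R x ∧ fiber g μ x)
fiber-pigeonhole {t = zero}  R g = [] , ≤-reflexive (begin
  count R                                ≡⟨ count-cong R≗R∧fiber ⟩
  count (λ x → R x ∧ fiber g [] x)       ≡⟨ *-identityˡ _ ⟨
  1 * count (λ x → R x ∧ fiber g [] x)   ∎)
  where
  open ≡-Reasoning
  R≗R∧fiber : ∀ x → R x ≡ R x ∧ fiber g [] x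
  R≗R∧fiber x = sym (trans (cong (R x ∧_) (fiber-[] g x)) (∧-identityʳ (R x)))
fiber-pigeonhole {t = suc t} R g =
  let b , halves = sum≤double-larger (count ∘ R[_])
      μ , bound  = fiber-pigeonhole R[ b ] (tail ∘ g)
  in b ∷ μ , (begin
    count R
      ≤⟨ count-mono R⊆R[false]∪R[true] ⟩
    count (λ x → R[ false ] x ∨ R[ true ] x)
      ≤⟨ ≤-trans (count-∨ R[ false ] R[ true ]) halves ⟩
    2 * count R[ b ]
      ≤⟨ *-monoʳ-≤ 2 bound ⟩
    2 * (2 ^ t * count (λ x → R[ b ] x ∧ fiber (tail ∘ g) μ x))
      ≡⟨ *-assoc 2 (2 ^ t) _ ⟨
    2 ^ suc t * count (λ x → R[ b ] x ∧ fiber (tail ∘ g) μ x)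
      ≡⟨ cong (2 ^ suc t *_) (count-cong (λ x →
           trans (∧-assoc (R x) _ _) (cong (R x ∧_) (sym (fiber-∷ g b μ x))))) ⟩
    2 ^ suc t * count (λ x → R x ∧ fiber g (b ∷ μ) x)
      ∎)
  where
  open ≤-Reasoning
  R[_] : Bool → Vec Bool _ → Bool
  R[ b ] x = R x ∧ does (head (g x) Bool.≟ b)
  R⊆R[false]∪R[true] : ∀ x → T (R x) → T (R[ false ] x ∨ R[ true ] x)
  R⊆R[false]∪R[true] x Rx with R x | head (g x)
  ... | true | false = tt
  ... | true | true  = tt

-- Subgroups of {0,1}ⁿ as kernels of parities

record IsSubgroup {n} (P : Vec Bool n → Bool) : Set where
  field
    zeros∈   : T (P zeros)
    ⊕-closed : ∀ {x y} → T (P x) → T (P y) → T (P (x ⊕ y))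

restrict-subgroup : ∀ {n} {P : Vec Bool (suc n) → Bool} → IsSubgroup P → IsSubgroup (P ∘ (false ∷_))
restrict-subgroup sub = record { zeros∈ = zeros∈ ; ⊕-closed = ⊕-closed }
  where open IsSubgroup sub

HasCodimension : ∀ {n} → (Vec Bool n → Bool) → ℕ → Set
HasCodimension {n} P r =
  Σ (Vec (Vec Bool n) r) λ s → (∀ x → parities s x ≡ zeros → T (P x)) × 2 ^ r * count P ≡ 2 ^ n

-- Either P lies in the hyperplane x₀ = 0 and the form x₀ is added, or P meets x₀ = 1 in a
-- coset (true ∷ q) ⊕ P₀ and every form v of P₀ is extended by ⟨ v , q ⟩.
module CodimensionStep {n} {P : Vec Bool (suc n) → Bool} (sub : IsSubgroup P)
  {r} (s : Vec (Vec Bool n) r) (ker : ∀ y → parities s y ≡ zeros → T (P (false ∷ y)))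
  (size : 2 ^ r * count (P ∘ (false ∷_)) ≡ 2 ^ n) where

  open IsSubgroup sub

  P₀ P₁ : Vec Bool n → Bool
  P₀ = P ∘ (false ∷_)
  P₁ = P ∘ (true ∷_)

  hyperplane : count P₁ ≡ 0 → HasCodimension P (suc r)
  hyperplane count₁≡0 = (true ∷ zeros) ∷ map (false ∷_) s , ker′ , size′
    where
    ker′ : ∀ x → parities ((true ∷ zeros) ∷ map (false ∷_) s) x ≡ zeros → T (P x)
    ker′ (false ∷ y) ≡zeros =
      ker y (trans (sym (parities-false∷ (λ _ → false) s y)) (∷-injectiveʳ ≡zeros))
    ker′ (true ∷ y)  ≡zeros with () ← trans (cong not (sym (⟨zeros,⟩ y))) (∷-injectiveˡ ≡zeros)
    size′ : 2 ^ suc r * (count P₀ + count P₁) ≡ 2 ^ suc n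
    size′ = begin
      2 * 2 ^ r * (count P₀ + count P₁)   ≡⟨ cong (λ c → 2 * 2 ^ r * (count P₀ + c)) count₁≡0 ⟩
      2 * 2 ^ r * (count P₀ + 0)          ≡⟨ cong (2 * 2 ^ r *_) (+-identityʳ (count P₀)) ⟩
      2 * 2 ^ r * count P₀                ≡⟨ *-assoc 2 (2 ^ r) (count P₀) ⟩
      2 * (2 ^ r * count P₀)              ≡⟨ cong (2 *_) size ⟩
      2 * 2 ^ n                           ∎
      where open ≡-Reasoning

  coset : ∃ (T ∘ P₁) → HasCodimension P r
  coset (q , q∈P₁) = map (λ v → ⟨ v , q ⟩ ∷ v) s , ker′ , size′
    where
    P₀⇒P₁ : ∀ y → T (P₀ (q ⊕ y)) → T (P₁ y)
    P₀⇒P₁ y P₀[q⊕y] = subst (T ∘ P₁) (⊕-cancelˡ q y) (⊕-closed q∈P₁ P₀[q⊕y])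
    ker′ : ∀ x → parities (map (λ v → ⟨ v , q ⟩ ∷ v) s) x ≡ zeros → T (P x)
    ker′ (false ∷ y) ≡zeros = ker y (trans (sym (parities-false∷ (λ v → ⟨ v , q ⟩) s y)) ≡zeros)
    ker′ (true ∷ y)  ≡zeros = P₀⇒P₁ y (ker (q ⊕ y) (trans (sym (parities-true∷ q s y)) ≡zeros))
    count₁≡count₀ : count P₁ ≡ count P₀
    count₁≡count₀ = trans
      (≤-antisym (count-mono {Q = P₀ ∘ (q ⊕_)} (λ _ → ⊕-closed q∈P₁)) (count-mono P₀⇒P₁))
      (count-translate q P₀)
    size′ : 2 ^ r * (count P₀ + count P₁) ≡ 2 ^ suc n
    size′ = begin
      2 ^ r * (count P₀ + count P₁)         ≡⟨ cong (λ c → 2 ^ r * (count P₀ + c)) count₁≡count₀ ⟩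
      2 ^ r * (count P₀ + count P₀)         ≡⟨ *-distribˡ-+ (2 ^ r) (count P₀) (count P₀) ⟩
      2 ^ r * count P₀ + 2 ^ r * count P₀   ≡⟨ cong₂ _+_ size size ⟩
      2 ^ n + 2 ^ n                         ≡⟨ cong (2 ^ n +_) (+-identityʳ (2 ^ n)) ⟨
      2 ^ suc n                             ∎
      where open ≡-Reasoning

subgroup-codimension : ∀ {n} {P : Vec Bool n → Bool} → IsSubgroup P → ∃ (HasCodimension P)
subgroup-codimension {zero} {P} sub = 0 , [] , (λ { [] _ → zeros∈ }) , size
  where
  open IsSubgroup sub
  size : 1 * count P ≡ 1
  size with P [] | zeros∈
  ... | true | _ = refl
subgroup-codimension {suc n} {P} sub with subgroup-codimension (restrict-subgroup sub)
... | r , s , ker , size with 0 <? count (P ∘ (true ∷_))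
...   | no  0≮count₁ = suc r , hyperplane (n≤0⇒n≡0 (≮⇒≥ 0≮count₁))
  where open CodimensionStep sub s ker size
...   | yes 0<count₁ = r , coset (count-witness (P ∘ (true ∷_)) 0<count₁)
  where open CodimensionStep sub s ker size

Periodic : ∀ {n} → (Vec Bool n → Bool) → Vec Bool n → Set
Periodic g w = ∀ y → g y ≡ g (y ⊕ w)

periodic? : ∀ {n} (g : Vec Bool n → Bool) w → Dec (Periodic g w)
periodic? g w = ∀? λ y → g y Bool.≟ g (y ⊕ w)

isPeriod : ∀ {n} → (Vec Bool n → Bool) → Vec Bool n → Bool
isPeriod g w = does (periodic? g w)

periods-subgroup : ∀ {n} (g : Vec Bool n → Bool) → IsSubgroup (isPeriod g)
periods-subgroup g = record
  { zeros∈   = ⇒does (periodic? g zeros) λ y → cong g (sym (⊕-identityʳ y))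
  ; ⊕-closed = λ {w} {w′} w∈ w′∈ → ⇒does (periodic? g (w ⊕ w′)) λ y → begin
      g y                ≡⟨ does⇒ (periodic? g w) w∈ y ⟩
      g (y ⊕ w)          ≡⟨ does⇒ (periodic? g w′) w′∈ (y ⊕ w) ⟩
      g ((y ⊕ w) ⊕ w′)   ≡⟨ cong g (⊕-assoc y w w′) ⟩
      g (y ⊕ (w ⊕ w′))   ∎
  }
  where open ≡-Reasoning

napdt⇒protocol : ∀ {n p} {f : Partial n} → NAPDT f p → OneWayProtocol f p
napdt⇒protocol (s , l , correct) =
  parities s , (λ v y → l (v ⊕ parities s y)) ,
  λ x y b f[x⊕y] → trans (cong l (sym (parities-⊕ s x y))) (correct (x ⊕ y) b f[x⊕y])

napdt-from-parity-fibers : ∀ {n p} (f : Partial n) (s : Vec (Vec Bool n) p) →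
  (∀ {x x′ b b′} → parities s x ≡ parities s x′ → f x ≡ just b → f x′ ≡ just b′ → b ≡ b′) →
  NAPDT f p
napdt-from-parity-fibers {n} {p} f s consistent = s , l , correct
  where
  TruePreimage : Vec Bool p → Vec Bool n → Set
  TruePreimage v x = parities s x ≡ v × f x ≡ just true
  l : Vec Bool p → Bool
  l v = does (∃? λ x → ≡-dec Bool._≟_ (parities s x) v ×-dec Maybe.≡-dec Bool._≟_ (f x) (just true))
  correct : ∀ x b → f x ≡ just b → l (parities s x) ≡ b
  correct x true  fx = dec-true (∃? _) (x , refl , fx)
  correct x false fx = dec-false (∃? _) no-true-preimage
    where
    no-true-preimage : ¬ ∃ (TruePreimage (parities s x))
    no-true-preimage (x′ , same , fx′) with () ← consistent (sym same) fx fx′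

truncate-map-padRight : ∀ {A B : Set} {m n} (m≤n : m ≤ n) (g : A → B) a (xs : Vec A m) →
  truncate m≤n (map g (padRight m≤n a xs)) ≡ map g xs
truncate-map-padRight z≤n       g a []       = refl
truncate-map-padRight (s≤s m≤n) g a (x ∷ xs) = cong (g x ∷_) (truncate-map-padRight m≤n g a xs)

napdt-weaken : ∀ {n r p} {f : Partial n} → r ≤ p → NAPDT f r → NAPDT f p
napdt-weaken r≤p (s , l , correct) =
  padRight r≤p zeros s , l ∘ truncate r≤p ,
  λ x b fx → trans (cong l (truncate-map-padRight r≤p _ zeros s)) (correct x b fx)

-- Sums of binomial coefficients

binomialPrefix : ℕ → ℕ → ℕ
binomialPrefix N zero    = 0
binomialPrefix N (suc k) = binomialPrefix N k + N C k

binomialPrefix-pascal : ∀ N k →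
  binomialPrefix (suc N) (suc k) ≡ binomialPrefix N k + binomialPrefix N (suc k)
binomialPrefix-pascal N zero    = refl
binomialPrefix-pascal N (suc k) = begin
  binomialPrefix (suc N) (suc k) + suc N C suc k
    ≡⟨ cong₂ _+_ (binomialPrefix-pascal N k) (sym (nCk+nC[k+1]≡[n+1]C[k+1] N k)) ⟩
  (binomialPrefix N k + binomialPrefix N (suc k)) + (N C k + N C suc k)
    ≡⟨ +-interchange (binomialPrefix N k) _ _ _ ⟩
  (binomialPrefix N k + N C k) + (binomialPrefix N (suc k) + N C suc k)
    ∎
  where open ≡-Reasoning

binomialPrefix-total : ∀ N → binomialPrefix N (suc N) ≡ 2 ^ N
binomialPrefix-total zero    = refl
binomialPrefix-total (suc N) = begin
  binomialPrefix (suc N) (suc (suc N))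
    ≡⟨ binomialPrefix-pascal N (suc N) ⟩
  binomialPrefix N (suc N) + (binomialPrefix N (suc N) + N C suc N)
    ≡⟨ cong (λ c → binomialPrefix N (suc N) + (binomialPrefix N (suc N) + c))
            (k>n⇒nCk≡0 (n<1+n N)) ⟩
  binomialPrefix N (suc N) + (binomialPrefix N (suc N) + 0)
    ≡⟨ cong (λ c → c + (c + 0)) (binomialPrefix-total N) ⟩
  2 ^ suc N
    ∎
  where open ≡-Reasoning

binomialPrefix-mono : ∀ N {j k} → j ≤ k → binomialPrefix N j ≤ binomialPrefix N k
binomialPrefix-mono N {k = zero}  z≤n = ≤-refl
binomialPrefix-mono N {k = suc k} j≤1+k with m≤n⇒m<n∨m≡n j≤1+k
... | inj₁ (s≤s j≤k) = ≤-trans (binomialPrefix-mono N j≤k) (m≤m+n _ _)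
... | inj₂ refl      = ≤-refl

binomialPrefix-+C : ∀ N {j k} → j ≤ k → binomialPrefix N j + N C k ≤ binomialPrefix N (suc k)
binomialPrefix-+C N j≤k = +-monoˡ-≤ _ (binomialPrefix-mono N j≤k)

four-binomials≤ : ∀ N {a b c d} → a < b → b < c → c < d → d ≤ N →
  N C a + N C b + N C c + N C d ≤ 2 ^ N
four-binomials≤ N {a} {b} {c} {d} a<b b<c c<d d≤N = begin
  N C a + N C b + N C c + N C d
    ≤⟨ +-monoˡ-≤ _ (+-monoˡ-≤ _ (+-monoˡ-≤ _ (binomialPrefix-+C N {k = a} z≤n))) ⟩
  binomialPrefix N (suc a) + N C b + N C c + N C d
    ≤⟨ +-monoˡ-≤ _ (+-monoˡ-≤ _ (binomialPrefix-+C N a<b)) ⟩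
  binomialPrefix N (suc b) + N C c + N C d
    ≤⟨ +-monoˡ-≤ _ (binomialPrefix-+C N b<c) ⟩
  binomialPrefix N (suc c) + N C d
    ≤⟨ binomialPrefix-+C N c<d ⟩
  binomialPrefix N (suc d)
    ≤⟨ binomialPrefix-mono N (s≤s d≤N) ⟩
  binomialPrefix N (suc N)
    ≡⟨ binomialPrefix-total N ⟩
  2 ^ N
    ∎
  where open ≤-Reasoning

-- Pascal's rule and symmetry write 2·C(m+1, i+1) as four distinct entries of row m.
double-binomial≤ : ∀ m k → 1 ≤ k → 2 * k ≤ m → 2 * (suc m C (k ∸ 1)) ≤ 2 ^ m
double-binomial≤ m 1             _ 2≤m  = ^-monoʳ-≤ 2 (≤-trans (s≤s z≤n) 2≤m)
double-binomial≤ m (suc (suc i)) _ 2k≤m = begin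
  2 * (suc m C suc i)                                 ≡⟨ cong (2 *_) (nCk+nC[k+1]≡[n+1]C[k+1] m i) ⟨
  2 * (m C i + m C suc i)                             ≡⟨ double-as-four (m C i) (m C suc i) ⟩
  m C i + m C suc i + m C suc i + m C i               ≡⟨ cong₂ (λ c c′ → m C i + m C suc i + c + c′)
                                                           (nCk≡nC[n∸k] 1+i≤m) (nCk≡nC[n∸k] i≤m) ⟩
  m C i + m C suc i + m C (m ∸ suc i) + m C (m ∸ i)   ≤⟨ four-binomials≤ m ≤-refl 1+i<m∸[1+i]
                                                           (∸-monoʳ-< (n<1+n i) 1+i≤m) (m∸n≤m m i) ⟩
  2 ^ m                                               ∎
  where
  open ≤-Reasoning
  double-as-four : ∀ x y → 2 * (x + y) ≡ x + y + y + x
  double-as-four = solve-∀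
  2+i+1+i≤m : suc (suc i) + suc i ≤ m
  2+i+1+i≤m = ≤-trans (+-monoʳ-≤ (suc (suc i)) (≤-trans (n≤1+n (suc i)) (m≤m+n _ 0))) 2k≤m
  1+i<m∸[1+i] : suc i < m ∸ suc i
  1+i<m∸[1+i] = m+n≤o⇒m≤o∸n (suc (suc i)) 2+i+1+i≤m
  1+i≤m : suc i ≤ m
  1+i≤m = ≤-trans (m≤m+n (suc i) _) (≤-trans (n≤1+n _) 2+i+1+i≤m)
  i≤m : i ≤ m
  i≤m = ≤-trans (n≤1+n i) 1+i≤m

binomial-bound : ∀ m → 1 ≤ m / 2 → 2 * ((m + 1) C (m / 2 ∸ 1)) ≤ 2 ^ m
binomial-bound m 1≤m/2 rewrite +-comm m 1 =
  double-binomial≤ m (m / 2) 1≤m/2 (subst (_≤ m) (*-comm (m / 2) 2) (m/n*n≤m m 2))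

-- From a protocol to a parity tree

defined : (m : Maybe Bool) → T (not (is-nothing m)) → ∃ λ b → m ≡ just b
defined (just b) _ = b , refl

2^-cancel-≤ : ∀ {m n} → 2 ^ m ≤ 2 ^ n → m ≤ n
2^-cancel-≤ 2^m≤2^n = ≮⇒≥ (λ n<m → <⇒≱ (^-monoʳ-< 2 (s≤s (s≤s z≤n)) n<m) 2^m≤2^n)

module MessageFiber {n t} (f : Partial n) (h : Vec Bool n → Vec Bool t)
  (φ : Vec Bool t → Vec Bool n → Bool) (correct : ∀ x y b → f (x ⊕ y) ≡ just b → φ (h x) y ≡ b)
  (μ : Vec Bool t) where

  A : Vec Bool n → Bool
  A = fiber h μ

  out : Vec Bool n → Bool
  out = φ μ

  u : ℕ
  u = count (is-nothing ∘ f)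

  out-correct : ∀ {a y b} → T (A a) → f (a ⊕ y) ≡ just b → out y ≡ b
  out-correct {a} {y} a∈A f[a⊕y] =
    subst (λ m → φ m y ≡ _) (does⇒ (≡-dec Bool._≟_ (h a) μ) a∈A) (correct a y _ f[a⊕y])

  period-consistent : ∀ {a₀ w z b b′} → T (A a₀) → T (isPeriod out w) →
    f z ≡ just b → f (z ⊕ w) ≡ just b′ → b ≡ b′
  period-consistent {a₀} {w} {z} {b} {b′} a₀∈A w∈ fz f[z⊕w] = begin
    b                    ≡⟨ out-correct a₀∈A (trans (cong f (⊕-cancelˡ a₀ z)) fz) ⟨
    out (a₀ ⊕ z)         ≡⟨ does⇒ (periodic? out w) w∈ (a₀ ⊕ z) ⟩
    out ((a₀ ⊕ z) ⊕ w)   ≡⟨ out-correct a₀∈A (trans (cong f a₀⊕[a₀⊕z⊕w]≡z⊕w) f[z⊕w]) ⟩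
    b′                   ∎
    where
    open ≡-Reasoning
    a₀⊕[a₀⊕z⊕w]≡z⊕w : a₀ ⊕ ((a₀ ⊕ z) ⊕ w) ≡ z ⊕ w
    a₀⊕[a₀⊕z⊕w]≡z⊕w = trans (cong (a₀ ⊕_) (⊕-assoc a₀ z w)) (⊕-cancelˡ a₀ (z ⊕ w))

  -- a avoids the undefined points at y and at y ⊕ a₁ ⊕ a₂, and both values of f there are
  -- read off by Bob at the single point a₁ ⊕ a ⊕ y.
  differences-periods : u + u < count A → ∀ {a₁ a₂} → T (A a₁) → T (A a₂) →
    T (isPeriod out (a₁ ⊕ a₂))
  differences-periods dense {a₁} {a₂} a₁∈A a₂∈A = ⇒does (periodic? out (a₁ ⊕ a₂)) periodic
    where
    periodic : Periodic out (a₁ ⊕ a₂)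
    periodic y with avoid-two-translates A (is-nothing ∘ f) dense y (y ⊕ (a₁ ⊕ a₂))
    ... | a , a∈A , def , def′ with defined _ def | defined _ def′
    ... | b , fb | b′ , fb′ = begin
      out y                 ≡⟨ out-correct a∈A fb ⟩
      b                     ≡⟨ out-correct a₁∈A (trans (cong f (⊕-cancelˡ a₁ (a ⊕ y))) fb) ⟨
      out (a₁ ⊕ (a ⊕ y))    ≡⟨ out-correct a₂∈A (trans (cong f rearrange) fb′) ⟩
      b′                    ≡⟨ out-correct a∈A fb′ ⟨
      out (y ⊕ (a₁ ⊕ a₂))   ∎
      where
      open ≡-Reasoning
      rearrange : a₂ ⊕ (a₁ ⊕ (a ⊕ y)) ≡ a ⊕ (y ⊕ (a₁ ⊕ a₂))
      rearrange = begin
        a₂ ⊕ (a₁ ⊕ (a ⊕ y))   ≡⟨ ⊕-Properties.x∙yz≈zy∙x a₂ a₁ (a ⊕ y) ⟩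
        ((a ⊕ y) ⊕ a₁) ⊕ a₂   ≡⟨ ⊕-assoc (a ⊕ y) a₁ a₂ ⟩
        (a ⊕ y) ⊕ (a₁ ⊕ a₂)   ≡⟨ ⊕-assoc a y (a₁ ⊕ a₂) ⟩
        a ⊕ (y ⊕ (a₁ ⊕ a₂))   ∎

  napdt : 2 ^ n ≤ 2 ^ t * count A → 2 ^ t * (u + u) < 2 ^ n → NAPDT f t
  napdt 2^n≤2^t*|A| few-undefined =
    from-kernel (count-witness A (≤-<-trans z≤n dense))
                (subgroup-codimension (periods-subgroup out))
    where
    dense : u + u < count A
    dense = *-cancelˡ-< (2 ^ t) _ _ (<-≤-trans few-undefined 2^n≤2^t*|A|)
    from-kernel : ∃ (T ∘ A) → ∃ (HasCodimension (isPeriod out)) → NAPDT f t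
    from-kernel (a₀ , a₀∈A) (r , s , ker⊆periods , index) =
      napdt-weaken r≤t (napdt-from-parity-fibers f s consistent)
      where
      |A|≤|periods| : count A ≤ count (isPeriod out)
      |A|≤|periods| = ≤-trans
        (count-mono {Q = isPeriod out ∘ (a₀ ⊕_)} (λ _ → differences-periods dense a₀∈A))
        (≤-reflexive (count-translate a₀ (isPeriod out)))
      instance
        |periods|≢0 : NonZero (count (isPeriod out))
        |periods|≢0 = >-nonZero (<-≤-trans (≤-<-trans z≤n dense) |A|≤|periods|)
      r≤t : r ≤ t
      r≤t = 2^-cancel-≤ (*-cancelʳ-≤ (2 ^ r) (2 ^ t) (count (isPeriod out)) (begin
        2 ^ r * count (isPeriod out)   ≡⟨ index ⟩
        2 ^ n                          ≤⟨ 2^n≤2^t*|A| ⟩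
        2 ^ t * count A                ≤⟨ *-monoʳ-≤ (2 ^ t) |A|≤|periods| ⟩
        2 ^ t * count (isPeriod out)   ∎))
        where open ≤-Reasoning
      consistent : ∀ {x x′ b b′} → parities s x ≡ parities s x′ →
        f x ≡ just b → f x′ ≡ just b′ → b ≡ b′
      consistent {x} {x′} same fx fx′ =
        period-consistent a₀∈A (ker⊆periods (x ⊕ x′) x⊕x′∈ker)
                          fx (trans (cong f (⊕-cancelˡ x x′)) fx′)
        where
        x⊕x′∈ker : parities s (x ⊕ x′) ≡ zeros
        x⊕x′∈ker = trans (parities-⊕ s x x′) (trans (cong (_⊕ parities s x′) same) (⊕-self _))

protocol⇒napdt : ∀ {n t} (f : Partial n) → OneWayProtocol f t →
  2 ^ t * (count (is-nothing ∘ f) + count (is-nothing ∘ f)) < 2 ^ n → NAPDT f t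
protocol⇒napdt {n} {t} f (h , φ , correct) with fiber-pigeonhole (λ _ → true) h
... | μ , pigeonhole =
  MessageFiber.napdt f h φ correct μ
    (subst (_≤ 2 ^ t * count (fiber h μ)) (count-true n) pigeonhole)

theorem19 : ∀ (n t : ℕ) (f : Partial n) → Dcc→ f t
    → 1 ≤ (n ∸ t) / 2
    → undefCount f < (n ∸ t + 1) C ((n ∸ t) / 2 ∸ 1)
    → NADT⊕ f t
theorem19 n t f (protocol , minimal) 1≤m/2 few-undefined =
  protocol⇒napdt f protocol 2^t*2u<2^n , λ p tree → minimal p (napdt⇒protocol tree)
  where
  m = n ∸ t
  u = count (is-nothing ∘ f)
  binom = (m + 1) C (m / 2 ∸ 1)
  u<binom : u < binom
  u<binom = subst (_< binom) (undefCount≡count f) few-undefined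
  t≤n : t ≤ n
  t≤n = <⇒≤ (m∸n≢0⇒n<m λ m≡0 → case subst (λ k → 1 ≤ k / 2) m≡0 1≤m/2 of λ ())
  2^t*2u<2^n : 2 ^ t * (u + u) < 2 ^ n
  2^t*2u<2^n = begin-strict
    2 ^ t * (u + u)       <⟨ *-monoʳ-< (2 ^ t) {{m^n≢0 2 t}}
                               (+-mono-< u<binom (≤-trans u<binom (m≤m+n binom 0))) ⟩
    2 ^ t * (2 * binom)   ≤⟨ *-monoʳ-≤ (2 ^ t) (binomial-bound m 1≤m/2) ⟩
    2 ^ t * 2 ^ m         ≡⟨ ^-distribˡ-+-* 2 t m ⟨
    2 ^ (t + m)           ≡⟨ cong (2 ^_) (m+[n∸m]≡n t≤n) ⟩
    2 ^ n                 ∎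
    where open ≤-Reasoning
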